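{- Let $\mathcal{P}$ be a convex two-dimensional pattern and let $u,v$ be a basis of $\mathbb{Z}^2$. Then there exist an integer $n\ge0$ and integers $l_0,\dots,l_n,r_0,\dots,r_n$ with $l_0<r_0$, $l_i\le r_i$ for $1\le i\le n-1$, and $l_n<r_n$, such that the figure \[F_{u,v}(l_0,\dots,l_n;r_0,\dots,r_n)=\{iu+jv:\ 0\le i\le n,\ l_i\le j<r_i\}\] belongs to $\mathcal{P}$.
   Context: A figure is a finite subset of $\mathbb{Z}^2$; a pattern is the set of all integer translates of a fixed figure. A figure $F$ is convex if $F=\mathrm{conv}_{\mathbb{R}^2}(F)\cap\mathbb{Z}^2$, and a pattern is convex if its figures are convex. -}

module Defs where

open import Data.Integer as ℤ using (ℤ; +_)
open import Data.Rational as ℚ using (ℚ; _/_; 0ℚ; 1ℚ)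
open import Data.Product using (Σ; ∃; ∃-syntax; _×_; _,_)
open import Data.List using (List; []; _∷_)
open import Data.List.Relation.Unary.All using (All)
open import Data.List.Membership.Propositional using (_∈_)
open import Data.Fin using (Fin; toℕ)
open import Data.Nat as ℕ using (ℕ)
open import Relation.Binary.PropositionalEquality using (_≡_)
open import Function.Bundles using (_⇔_)

Point : Set
Point = ℤ × ℤ

_⊕_ : Point → Point → Point
(a , b) ⊕ (c , d) = (a ℤ.+ c , b ℤ.+ d)

_⊖_ : Point → Point → Point
(a , b) ⊖ (c , d) = (a ℤ.- c , b ℤ.- d)

_·_ : ℤ → Point → Point
k · (a , b) = (k ℤ.* a , k ℤ.* b)

origin : Point
origin = (+ 0 , + 0)

-- A figure: a finite subset of ℤ², given by a finite list of its points
-- (membership is list membership; duplicates/order irrelevant).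
Figure : Set
Figure = List Point

PointSet : Set₁
PointSet = Point → Set

toℚ : ℤ → ℚ
toℚ z = z / 1

sumCoef : List (ℚ × Point) → ℚ
sumCoef [] = 0ℚ
sumCoef ((c , _) ∷ cs) = c ℚ.+ sumCoef cs

sumX : List (ℚ × Point) → ℚ
sumX [] = 0ℚ
sumX ((c , (x , _)) ∷ cs) = c ℚ.* toℚ x ℚ.+ sumX cs

sumY : List (ℚ × Point) → ℚ
sumY [] = 0ℚ
sumY ((c , (_ , y)) ∷ cs) = c ℚ.* toℚ y ℚ.+ sumY cs

InConvHull : Figure → Point → Set
InConvHull F (px , py) =
  Σ (List (ℚ × Point)) λ cs →
      All (λ cq → (0ℚ ℚ.≤ Data.Product.proj₁ cq) × (Data.Product.proj₂ cq ∈ F)) cs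
    × sumCoef cs ≡ 1ℚ
    × sumX cs ≡ toℚ px
    × sumY cs ≡ toℚ py

-- F is convex: F = conv(F) ∩ ℤ² (the inclusion F ⊆ conv(F) ∩ ℤ² is automatic).
IsConvex : Figure → Set
IsConvex F = ∀ p → InConvHull F p → p ∈ F

-- G (a subset of ℤ²) belongs to the pattern of all integer translates of F.
InPattern : Figure → PointSet → Set
InPattern F G = ∃[ t ] (∀ w → G w ⇔ ((w ⊖ t) ∈ F))

IsBasis : Point → Point → Set
IsBasis u v =
    (∀ w → ∃[ a ] ∃[ b ] ((a · u) ⊕ (b · v)) ≡ w)
  × (∀ a b → ((a · u) ⊕ (b · v)) ≡ origin → (a ≡ + 0) × (b ≡ + 0))

Fuv : Point → Point → (n : ℕ) → (Fin (ℕ.suc n) → ℤ) → (Fin (ℕ.suc n) → ℤ) → PointSet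
Fuv u v n l r w =
  ∃[ i ] ∃[ j ] ((l i ℤ.≤ j) × (j ℤ.< r i) × (((+ toℕ i) · u) ⊕ (j · v)) ≡ w)

-- Cut F into its slices along v: in the coordinates of the basis (u, v), the
-- points of F with first coordinate k.  Since F is convex, each slice contains
-- every lattice point between two of its points, so it is a half-open integer
-- interval [lₖ, rₖ).  The first coordinates of F fill an interval [K₀, K₁]
-- whose two extreme slices are nonempty, and translating by -K₀ u turns F into
-- F_{u,v}(l; r) with n = K₁ - K₀.
module Submission where

open import Defs
open import Data.Integer using (ℤ; _≤_; _<_)
open import Data.Nat as ℕ using (ℕ)
open import Data.Fin using (Fin; toℕ; fromℕ; zero)
open import Data.Product using (Σ; ∃; ∃-syntax; _×_; _,_)
open import Data.List.Membership.Propositional using (_∈_)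

open import Data.Nat using (suc)
import Data.Nat.Properties as ℕP
import Data.Integer as ℤ
open import Data.Integer using (+_; ∣_∣)
import Data.Integer.Properties as ℤP
open import Data.Integer.Tactic.RingSolver using (solve-∀)
import Data.Rational as ℚ
import Data.Rational.Properties as ℚP
import Data.Rational.Unnormalised as U
import Data.Rational.Unnormalised.Properties as UP
import Data.Fin as Fin
import Data.Fin.Properties as FinP
open import Data.Product using (∃₂; proj₁; proj₂)
open import Data.Sum using ([_,_]′)
open import Data.List using (List; []; _∷_; map; filter)
open import Data.List.Relation.Unary.All using (All; _∷_; []; lookup)
open import Data.List.Relation.Unary.Any using (here; there)
open import Data.List.Membership.Propositional.Properties
  using (∈-map⁺; ∈-map⁻; ∈-filter⁺; ∈-filter⁻)
open import Data.List.Extrema ℤP.≤-totalOrder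
  using (min; max; argmin-sel; argmax-sel; min≤⊤; min≤xs; ⊥≤max; xs≤max)
open import Data.Empty using (⊥-elim)
open import Function using (id)
open import Function.Bundles using (mk⇔)
open import Relation.Binary.PropositionalEquality

module _ where
  open import Relation.Binary.Reasoning.Setoid UP.≃-setoid

  toℚᵘ-scaled : ∀ a x m →
    ℚ.toℚᵘ ((a ℚ./ suc m) ℚ.* toℚ x) U.≃ U.mkℚᵘ (a ℤ.* x) m
  toℚᵘ-scaled a x m = begin
    ℚ.toℚᵘ ((a ℚ./ suc m) ℚ.* toℚ x)
      ≈⟨ ℚP.toℚᵘ-homo-* (a ℚ./ suc m) (toℚ x) ⟩
    ℚ.toℚᵘ (a ℚ./ suc m) U.* ℚ.toℚᵘ (toℚ x)
      ≈⟨ UP.*-cong (ℚP.toℚᵘ-fromℚᵘ (U.mkℚᵘ a m)) (ℚP.toℚᵘ-fromℚᵘ (U.mkℚᵘ x 0)) ⟩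
    U.mkℚᵘ a m U.* U.mkℚᵘ x 0
      ≈⟨ U.*≡* (cong (λ d → a ℤ.* x ℤ.* + suc d) (sym (ℕP.*-identityʳ m))) ⟩
    U.mkℚᵘ (a ℤ.* x) m ∎

  mkℚᵘ-+ : ∀ a b m → U.mkℚᵘ a m U.+ U.mkℚᵘ b m U.≃ U.mkℚᵘ (a ℤ.+ b) m
  mkℚᵘ-+ a b m = U.*≡* (identity a b (+ suc m))
    where
    identity : ∀ a b d → (a ℤ.* d ℤ.+ b ℤ.* d) ℤ.* d ≡ (a ℤ.+ b) ℤ.* (d ℤ.* d)
    identity = solve-∀

  mkℚᵘ-cancel : ∀ a m → U.mkℚᵘ (a ℤ.* + suc m) m U.≃ U.mkℚᵘ a 0
  mkℚᵘ-cancel a m = U.*≡* (identity a (+ suc m))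
    where
    identity : ∀ a d → a ℤ.* d ℤ.* + 1 ≡ a ℤ.* d
    identity = solve-∀

  -- Stated with the trailing 0ℚ so that it matches sumX/sumY of a two-point list.
  toℚ-weighted-mean : ∀ k₁ k₂ m x₁ x₂ y →
    + k₁ ℤ.* x₁ ℤ.+ + k₂ ℤ.* x₂ ≡ y ℤ.* + suc m →
    (+ k₁ ℚ./ suc m) ℚ.* toℚ x₁ ℚ.+ ((+ k₂ ℚ./ suc m) ℚ.* toℚ x₂ ℚ.+ ℚ.0ℚ) ≡ toℚ y
  toℚ-weighted-mean k₁ k₂ m x₁ x₂ y mean =
    trans (cong (c₁x₁ ℚ.+_) (ℚP.+-identityʳ c₂x₂)) (ℚP.toℚᵘ-injective (begin
      ℚ.toℚᵘ (c₁x₁ ℚ.+ c₂x₂)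
        ≈⟨ ℚP.toℚᵘ-homo-+ c₁x₁ c₂x₂ ⟩
      ℚ.toℚᵘ c₁x₁ U.+ ℚ.toℚᵘ c₂x₂
        ≈⟨ UP.+-cong (toℚᵘ-scaled (+ k₁) x₁ m) (toℚᵘ-scaled (+ k₂) x₂ m) ⟩
      U.mkℚᵘ (+ k₁ ℤ.* x₁) m U.+ U.mkℚᵘ (+ k₂ ℤ.* x₂) m
        ≈⟨ mkℚᵘ-+ (+ k₁ ℤ.* x₁) (+ k₂ ℤ.* x₂) m ⟩
      U.mkℚᵘ (+ k₁ ℤ.* x₁ ℤ.+ + k₂ ℤ.* x₂) m
        ≡⟨ cong (λ a → U.mkℚᵘ a m) mean ⟩
      U.mkℚᵘ (y ℤ.* + suc m) m
        ≈⟨ mkℚᵘ-cancel y m ⟩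
      U.mkℚᵘ y 0
        ≈⟨ UP.≃-sym (ℚP.toℚᵘ-fromℚᵘ (U.mkℚᵘ y 0)) ⟩
      ℚ.toℚᵘ (toℚ y) ∎))
    where
    c₁x₁ = (+ k₁ ℚ./ suc m) ℚ.* toℚ x₁
    c₂x₂ = (+ k₂ ℚ./ suc m) ℚ.* toℚ x₂

fraction-nonNeg : ∀ k m → ℚ.0ℚ ℚ.≤ (+ k ℚ./ suc m)
fraction-nonNeg k m = ℚP.nonNegative⁻¹ (+ k ℚ./ suc m) {{ℚP.normalize-nonNeg k (suc m)}}

+∣j-i∣≡j-i : ∀ {i j} → i ≤ j → + ∣ j ℤ.- i ∣ ≡ j ℤ.- i
+∣j-i∣≡j-i i≤j = ℤP.0≤i⇒+∣i∣≡i (ℤP.i≤j⇒0≤j-i i≤j)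

i+[j-i]≡j : ∀ i j → i ℤ.+ (j ℤ.- i) ≡ j
i+[j-i]≡j = solve-∀

module _ {F : Figure} (convex : IsConvex F) where

  -- Weights k₁/(k₁+k₂) at b - k₂ and k₂/(k₁+k₂) at b + k₁ average to b.
  ∈-segment : ∀ p v b k₁ k₂ →
    p ⊕ ((b ℤ.- + k₂) · v) ∈ F → p ⊕ ((b ℤ.+ + k₁) · v) ∈ F → p ⊕ (b · v) ∈ F
  ∈-segment p v b k₁ ℕ.zero h₁ _ = subst (λ c → p ⊕ (c · v) ∈ F) (ℤP.+-identityʳ b) h₁
  ∈-segment (p₁ , p₂) (v₁ , v₂) b k₁ (suc k) h₁ h₂ =
    convex _ (combination , weights , coefficients , coordinate p₁ v₁ , coordinate p₂ v₂)
    where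
    m = k₁ ℕ.+ k
    combination : List (ℚ.ℚ × Point)
    combination = (+ k₁ ℚ./ suc m , (p₁ , p₂) ⊕ ((b ℤ.- + suc k) · (v₁ , v₂)))
                ∷ (+ suc k ℚ./ suc m , (p₁ , p₂) ⊕ ((b ℤ.+ + k₁) · (v₁ , v₂))) ∷ []
    weights : All (λ (c , q) → (ℚ.0ℚ ℚ.≤ c) × (q ∈ F)) combination
    weights = (fraction-nonNeg k₁ m , h₁) ∷ (fraction-nonNeg (suc k) m , h₂) ∷ []

    total : + k₁ ℤ.+ + suc k ≡ + suc m
    total = trans (sym (ℤP.pos-+ k₁ (suc k))) (cong +_ (ℕP.+-suc k₁ k))

    unit-mean : ∀ K₁ K₂ → K₁ ℤ.* + 1 ℤ.+ K₂ ℤ.* + 1 ≡ + 1 ℤ.* (K₁ ℤ.+ K₂)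
    unit-mean = solve-∀

    collinear-mean : ∀ K₁ K₂ x b y →
      K₁ ℤ.* (x ℤ.+ (b ℤ.- K₂) ℤ.* y) ℤ.+ K₂ ℤ.* (x ℤ.+ (b ℤ.+ K₁) ℤ.* y)
        ≡ (x ℤ.+ b ℤ.* y) ℤ.* (K₁ ℤ.+ K₂)
    collinear-mean = solve-∀

    coefficients : sumCoef combination ≡ ℚ.1ℚ
    coefficients = trans
      (cong₂ (λ c₁ c₂ → c₁ ℚ.+ (c₂ ℚ.+ ℚ.0ℚ))
        (sym (ℚP.*-identityʳ (+ k₁ ℚ./ suc m))) (sym (ℚP.*-identityʳ (+ suc k ℚ./ suc m))))
      (toℚ-weighted-mean k₁ (suc k) m (+ 1) (+ 1) (+ 1)
        (trans (unit-mean (+ k₁) (+ suc k)) (cong (+ 1 ℤ.*_) total)))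

    coordinate : ∀ x y →
      (+ k₁ ℚ./ suc m) ℚ.* toℚ (x ℤ.+ (b ℤ.- + suc k) ℤ.* y)
        ℚ.+ ((+ suc k ℚ./ suc m) ℚ.* toℚ (x ℤ.+ (b ℤ.+ + k₁) ℤ.* y) ℚ.+ ℚ.0ℚ)
      ≡ toℚ (x ℤ.+ b ℤ.* y)
    coordinate x y = toℚ-weighted-mean k₁ (suc k) m
      (x ℤ.+ (b ℤ.- + suc k) ℤ.* y) (x ℤ.+ (b ℤ.+ + k₁) ℤ.* y) (x ℤ.+ b ℤ.* y)
      (trans (collinear-mean (+ k₁) (+ suc k) x b y) (cong ((x ℤ.+ b ℤ.* y) ℤ.*_) total))

  ∈-between : ∀ p v {a b c} → a ≤ b → b ≤ c →
    p ⊕ (a · v) ∈ F → p ⊕ (c · v) ∈ F → p ⊕ (b · v) ∈ F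
  ∈-between p v {a} {b} {c} a≤b b≤c hₐ h꜀ = ∈-segment p v b ∣ c ℤ.- b ∣ ∣ b ℤ.- a ∣
    (subst (λ d → p ⊕ (d · v) ∈ F) (sym below) hₐ)
    (subst (λ d → p ⊕ (d · v) ∈ F) (sym above) h꜀)
    where
    b-[b-a]≡a : ∀ a b → b ℤ.- (b ℤ.- a) ≡ a
    b-[b-a]≡a = solve-∀
    below : b ℤ.- + ∣ b ℤ.- a ∣ ≡ a
    below = trans (cong (λ d → b ℤ.- d) (+∣j-i∣≡j-i a≤b)) (b-[b-a]≡a a b)
    above : b ℤ.+ + ∣ c ℤ.- b ∣ ≡ c
    above = trans (cong (λ d → b ℤ.+ d) (+∣j-i∣≡j-i b≤c)) (i+[j-i]≡j b c)

min∈ : ∀ x xs → min x xs ∈ x ∷ xs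
min∈ x xs = [ here , there ]′ (argmin-sel id x xs)

max∈ : ∀ x xs → max x xs ∈ x ∷ xs
max∈ x xs = [ here , there ]′ (argmax-sel id x xs)

min≤∈ : ∀ {y} x xs → y ∈ x ∷ xs → min x xs ≤ y
min≤∈ x xs (here refl) = min≤⊤ x xs
min≤∈ x xs (there y∈xs) = lookup (min≤xs x xs) y∈xs

∈≤max : ∀ {y} x xs → y ∈ x ∷ xs → y ≤ max x xs
∈≤max x xs (here refl) = ⊥≤max x xs
∈≤max x xs (there y∈xs) = lookup (xs≤max x xs) y∈xs

≤⇒<suc : ∀ {i j} → i ≤ j → i < ℤ.suc j
≤⇒<suc i≤j = ℤP.suc[i]≤j⇒i<j (ℤP.suc-mono i≤j)

<suc⇒≤ : ∀ {i j} → i < ℤ.suc j → i ≤ j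
<suc⇒≤ {i} {j} i<j = subst (i ≤_) (ℤP.pred-suc j) (ℤP.i<j⇒i≤pred[j] i<j)

lower upper : List ℤ → ℤ
lower []       = + 0
lower (y ∷ ys) = min y ys
upper []       = + 0
upper (y ∷ ys) = ℤ.suc (max y ys)

∈⇒lower≤ : ∀ {y ys} → y ∈ ys → lower ys ≤ y
∈⇒lower≤ {ys = x ∷ xs} y∈ys = min≤∈ x xs y∈ys

∈⇒<upper : ∀ {y ys} → y ∈ ys → y < upper ys
∈⇒<upper {ys = x ∷ xs} y∈ys = ≤⇒<suc (∈≤max x xs y∈ys)

∈⇒lower<upper : ∀ {y ys} → y ∈ ys → lower ys < upper ys
∈⇒lower<upper y∈ys = ℤP.≤-<-trans (∈⇒lower≤ y∈ys) (∈⇒<upper y∈ys)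

lower≤upper : ∀ ys → lower ys ≤ upper ys
lower≤upper []       = ℤP.≤-refl
lower≤upper (y ∷ ys) = ℤP.<⇒≤ (∈⇒lower<upper {ys = y ∷ ys} (here refl))

lower≤j<upper⇒bracketed : ∀ ys {j} → lower ys ≤ j → j < upper ys →
  ∃₂ λ y₁ y₂ → y₁ ∈ ys × y₂ ∈ ys × y₁ ≤ j × j ≤ y₂
lower≤j<upper⇒bracketed []       l≤j j<u = ⊥-elim (ℤP.<-irrefl refl (ℤP.≤-<-trans l≤j j<u))
lower≤j<upper⇒bracketed (y ∷ ys) l≤j j<u = min y ys , max y ys , min∈ y ys , max∈ y ys , l≤j , <suc⇒≤ j<u

fin-offset : ∀ {lo k hi} → lo ≤ k → k ≤ hi →
  ∃[ i ] lo ℤ.+ + toℕ {suc ∣ hi ℤ.- lo ∣} i ≡ k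
fin-offset {lo} {k} {hi} lo≤k k≤hi = i , (begin
    lo ℤ.+ + toℕ i            ≡⟨ cong (λ d → lo ℤ.+ + d) (FinP.toℕ-fromℕ< d<1+n) ⟩
    lo ℤ.+ + ∣ k ℤ.- lo ∣     ≡⟨ cong (λ d → lo ℤ.+ d) (+∣j-i∣≡j-i lo≤k) ⟩
    lo ℤ.+ (k ℤ.- lo)         ≡⟨ i+[j-i]≡j lo k ⟩
    k                         ∎)
  where
  open ≡-Reasoning
  d≤n : ∣ k ℤ.- lo ∣ ℕ.≤ ∣ hi ℤ.- lo ∣
  d≤n = ℤP.drop‿+≤+ (subst₂ _≤_ (sym (+∣j-i∣≡j-i lo≤k)) (sym (+∣j-i∣≡j-i (ℤP.≤-trans lo≤k k≤hi)))
                                (ℤP.+-monoˡ-≤ (ℤ.- lo) k≤hi))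
  d<1+n = ℕ.s≤s d≤n
  i = Fin.fromℕ< d<1+n

point : Point → Point → ℤ → ℤ → Point
point u v a b = (a · u) ⊕ (b · v)

point-⊖ : ∀ u v a b c → point u v a b ⊖ ((ℤ.- c) · u) ≡ point u v (c ℤ.+ a) b
point-⊖ (u₁ , u₂) (v₁ , v₂) a b c = cong₂ _,_ (identity a b c u₁ v₁) (identity a b c u₂ v₂)
  where
  identity : ∀ a b c u v → (a ℤ.* u ℤ.+ b ℤ.* v) ℤ.- (ℤ.- c) ℤ.* u ≡ (c ℤ.+ a) ℤ.* u ℤ.+ b ℤ.* v
  identity = solve-∀

point-⊕ : ∀ u v a b c → point u v (c ℤ.+ a) b ⊕ ((ℤ.- c) · u) ≡ point u v a b
point-⊕ (u₁ , u₂) (v₁ , v₂) a b c = cong₂ _,_ (identity a b c u₁ v₁) (identity a b c u₂ v₂)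
  where
  identity : ∀ a b c u v → ((c ℤ.+ a) ℤ.* u ℤ.+ b ℤ.* v) ℤ.+ (ℤ.- c) ℤ.* u ≡ a ℤ.* u ℤ.+ b ℤ.* v
  identity = solve-∀

⊖-⊕-cancel : ∀ w t → (w ⊖ t) ⊕ t ≡ w
⊖-⊕-cancel (w₁ , w₂) (t₁ , t₂) = cong₂ _,_ (identity w₁ t₁) (identity w₂ t₂)
  where
  identity : ∀ w t → (w ℤ.- t) ℤ.+ t ≡ w
  identity = solve-∀

-- Only the spanning half of IsBasis is needed: coordinates are chosen, not required unique.
module Slices (F : Figure) (convex : IsConvex F) (p₀ : Point) (p₀∈F : p₀ ∈ F) (u v : Point)
              (spanning : ∀ w → ∃[ a ] ∃[ b ] point u v a b ≡ w) where

  coord₁ coord₂ : Point → ℤ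
  coord₁ w = proj₁ (spanning w)
  coord₂ w = proj₁ (proj₂ (spanning w))

  point-coord : ∀ w → point u v (coord₁ w) (coord₂ w) ≡ w
  point-coord w = proj₂ (proj₂ (spanning w))

  slice : ℤ → List ℤ
  slice k = map coord₂ (filter (λ w → coord₁ w ℤ.≟ k) F)

  ∈⇒∈slice : ∀ {w} → w ∈ F → coord₂ w ∈ slice (coord₁ w)
  ∈⇒∈slice w∈F = ∈-map⁺ coord₂ (∈-filter⁺ (λ w → coord₁ w ℤ.≟ _) w∈F refl)

  ∈slice⇒∈ : ∀ {k y} → y ∈ slice k → point u v k y ∈ F
  ∈slice⇒∈ {k} y∈ with ∈-map⁻ coord₂ y∈
  ... | w , w∈ , refl with ∈-filter⁻ (λ w → coord₁ w ℤ.≟ k) w∈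
  ... | w∈F , refl = subst (_∈ F) (sym (point-coord w)) w∈F

  levels : List ℤ
  levels = coord₁ p₀ ∷ map coord₁ F

  ∈⇒∈levels : ∀ {w} → w ∈ F → coord₁ w ∈ levels
  ∈⇒∈levels w∈F = there (∈-map⁺ coord₁ w∈F)

  ∈levels⇒slice-nonempty : ∀ {k} → k ∈ levels → lower (slice k) < upper (slice k)
  ∈levels⇒slice-nonempty (here refl) = ∈⇒lower<upper (∈⇒∈slice p₀∈F)
  ∈levels⇒slice-nonempty (there k∈) with ∈-map⁻ coord₁ k∈
  ... | w , w∈F , refl = ∈⇒lower<upper (∈⇒∈slice w∈F)

  bottom top : ℤ
  bottom = min (coord₁ p₀) (map coord₁ F)
  top    = max (coord₁ p₀) (map coord₁ F)

  bottom≤ : ∀ {k} → k ∈ levels → bottom ≤ k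
  bottom≤ = min≤∈ (coord₁ p₀) (map coord₁ F)

  ≤top : ∀ {k} → k ∈ levels → k ≤ top
  ≤top = ∈≤max (coord₁ p₀) (map coord₁ F)

  bottom∈levels : bottom ∈ levels
  bottom∈levels = min∈ (coord₁ p₀) (map coord₁ F)

  top∈levels : top ∈ levels
  top∈levels = max∈ (coord₁ p₀) (map coord₁ F)

  bottom≤top : bottom ≤ top
  bottom≤top = ℤP.≤-trans (bottom≤ (here refl)) (≤top (here refl))

  n : ℕ
  n = ∣ top ℤ.- bottom ∣

  level : Fin (suc n) → ℤ
  level i = bottom ℤ.+ + toℕ i

  l r : Fin (suc n) → ℤ
  l i = lower (slice (level i))
  r i = upper (slice (level i))

  first-slice : l zero < r zero
  first-slice = subst (λ k → lower (slice k) < upper (slice k)) (sym (ℤP.+-identityʳ bottom))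
    (∈levels⇒slice-nonempty bottom∈levels)

  last-slice : l (fromℕ n) < r (fromℕ n)
  last-slice = subst (λ k → lower (slice k) < upper (slice k)) (sym level-last)
    (∈levels⇒slice-nonempty top∈levels)
    where
    open ≡-Reasoning
    level-last : level (fromℕ n) ≡ top
    level-last = begin
      bottom ℤ.+ + toℕ (fromℕ n)  ≡⟨ cong (λ d → bottom ℤ.+ + d) (FinP.toℕ-fromℕ n) ⟩
      bottom ℤ.+ + n              ≡⟨ cong (λ d → bottom ℤ.+ d) (+∣j-i∣≡j-i bottom≤top) ⟩
      bottom ℤ.+ (top ℤ.- bottom) ≡⟨ i+[j-i]≡j bottom top ⟩
      top                         ∎

  t : Point
  t = (ℤ.- bottom) · u

  Fuv⊆F : ∀ w → Fuv u v n l r w → (w ⊖ t) ∈ F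
  Fuv⊆F _ (i , j , l≤j , j<r , refl)
    with lower≤j<upper⇒bracketed (slice (level i)) l≤j j<r
  ... | y₁ , y₂ , y₁∈ , y₂∈ , y₁≤j , j≤y₂ =
    subst (_∈ F) (sym (point-⊖ u v (+ toℕ i) j bottom))
      (∈-between convex (level i · u) v y₁≤j j≤y₂ (∈slice⇒∈ y₁∈) (∈slice⇒∈ y₂∈))

  F⊆Fuv : ∀ w → (w ⊖ t) ∈ F → Fuv u v n l r w
  F⊆Fuv w p∈F = i , coord₂ p , ∈⇒lower≤ y∈ , ∈⇒<upper y∈ , point≡w
    where
    open ≡-Reasoning
    p = w ⊖ t
    offset = fin-offset (bottom≤ (∈⇒∈levels p∈F)) (≤top (∈⇒∈levels p∈F))
    i = proj₁ offset
    level≡ : level i ≡ coord₁ p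
    level≡ = proj₂ offset
    y∈ : coord₂ p ∈ slice (level i)
    y∈ = subst (λ k → coord₂ p ∈ slice k) (sym level≡) (∈⇒∈slice p∈F)
    point≡w : point u v (+ toℕ i) (coord₂ p) ≡ w
    point≡w = begin
      point u v (+ toℕ i) (coord₂ p)         ≡⟨ point-⊕ u v (+ toℕ i) (coord₂ p) bottom ⟨
      point u v (level i) (coord₂ p) ⊕ t     ≡⟨ cong (λ k → point u v k (coord₂ p) ⊕ t) level≡ ⟩
      point u v (coord₁ p) (coord₂ p) ⊕ t    ≡⟨ cong (_⊕ t) (point-coord p) ⟩
      p ⊕ t                                  ≡⟨ ⊖-⊕-cancel w t ⟩
      w                                      ∎

proposition2 : (F : Figure) → (∃[ p ] p ∈ F) → IsConvex F →
    (u v : Point) → IsBasis u v →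
    ∃[ n ] Σ (Fin (ℕ.suc n) → ℤ) λ l → Σ (Fin (ℕ.suc n) → ℤ) λ r →
        (l zero < r zero)
      × (∀ (i : Fin (ℕ.suc n)) → 1 ℕ.≤ toℕ i → toℕ i ℕ.≤ n ℕ.∸ 1 → l i ≤ r i)
      × (l (fromℕ n) < r (fromℕ n))
      × InPattern F (Fuv u v n l r)
-- Inner slices of a convex figure are nonempty too, but only lᵢ ≤ rᵢ is asked for.
proposition2 F (p₀ , p₀∈F) convex u v (spanning , _) =
  n , l , r , first-slice , (λ i _ _ → lower≤upper (slice (level i))) , last-slice ,
  t , λ w → mk⇔ (Fuv⊆F w) (F⊆Fuv w)
  where open Slices F convex p₀ p₀∈F u v spanning
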